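{- Let $p$ be an odd prime and let $a$ be a positive integer. For any $k\in\{1,2,\ldots,(p^a-1)/2\}$ we have $$\operatorname{ord}_p\binom{p^a-k}{\frac{p^a-1}{2}-k}\le a-1.$$
   Context: $\operatorname{ord}_p(n)$ denotes the $p$-adic valuation of a nonzero integer $n$ (the exponent of the largest power of $p$ dividing $n$). -}

module Defs where

open import Data.Nat using (ℕ; suc; _^_)
open import Data.Nat.Divisibility using (_∣_)
open import Data.Product using (_×_)
open import Relation.Nullary using (¬_)

-- IsOrd p n e : e is the p-adic valuation of n, i.e. p^e ∣ n and p^(e+1) ∤ n.
-- (For n ≠ 0 and p ≥ 2 such e exists and is unique.)
IsOrd : ℕ → ℕ → ℕ → Set
IsOrd p n e = (p ^ e ∣ n) × ¬ (p ^ suc e ∣ n)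

module Submission where

-- The bound does not use that p is odd: for every prime p and all k ≤ n,
--
--     n < p ^ (N + 1)   implies   ord_p (n C k) ≤ N,
--
-- and the theorem is the case n = p^a - k, N = a - 1.  We prove this by
-- Legendre's formula.  For n < p^(N+1) every m ≤ n has
-- ord_p m = Σ_{j=1}^{N} [p^j ∣ m], hence ord_p (n!) = Σ_{j=1}^{N} c_j(n)
-- with c_j(n) the number of multiples of p^j in 1..n.  Since c_j(n) is
-- ⌊n / p^j⌋, it is subadditive up to one: c_j(r + s) ≤ c_j(r) + c_j(s) + 1.
-- Writing n! = (n C k) · k! · (n - k)! and comparing valuations gives
-- ord_p (n C k) ≤ N, one unit for each j.

open import Defs
open import Data.Nat using (ℕ; _^_; _∸_; _≤_; _/_; _%_)
open import Data.Nat.Primality using (Prime)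
open import Data.Nat.Combinatorics using (_C_)
open import Data.Product using (∃; _×_)
open import Relation.Binary.PropositionalEquality using (_≡_)

open import Data.Nat.Base using (zero; suc; _+_; _*_; _<_; _!; z≤n; s≤s; NonZero; >-nonZero⁻¹; nonTrivial⇒n>1)
open import Data.Nat.Properties
open import Data.Nat.Divisibility
  using (_∣_; divides; _∣?_; ∣-trans; ∣⇒≤; 1∣_; ∣1⇒≡1; m∣m*n; *-monoˡ-∣; *-cancelʳ-∣)
open import Data.Nat.Primality using (prime⇒nonZero; prime⇒nonTrivial; euclidsLemma)
open import Data.Nat.Combinatorics using (nCk≡n!/k![n-k]!; k![n∸k]!∣n!)
open import Data.Nat.DivMod using (m/n*n≡m; m/n≤m)
open import Data.Product using (_,_; proj₁; proj₂)
open import Data.Sum using ([_,_]′)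
open import Data.Empty using (⊥-elim)
open import Relation.Nullary using (yes; no; ¬_)
open import Relation.Binary.PropositionalEquality
  using (refl; sym; trans; cong; cong₂; subst; _≢_; module ≡-Reasoning)
open import Relation.Binary.Definitions using (tri<; tri≈; tri>)
open import Algebra.Properties.CommutativeSemigroup using (interchange)

sumTo : ℕ → (ℕ → ℕ) → ℕ
sumTo zero    f = 0
sumTo (suc N) f = f (suc N) + sumTo N f

sumTo-+ : ∀ N f g → sumTo N (λ j → f j + g j) ≡ sumTo N f + sumTo N g
sumTo-+ zero    f g = refl
sumTo-+ (suc N) f g = trans (cong (f (suc N) + g (suc N) +_) (sumTo-+ N f g))
  (interchange +-commutativeSemigroup (f (suc N)) (g (suc N)) (sumTo N f) (sumTo N g))

sumTo-mono : ∀ N f g → (∀ j → f j ≤ g j) → sumTo N f ≤ sumTo N g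
sumTo-mono zero    f g f≤g = z≤n
sumTo-mono (suc N) f g f≤g = +-mono-≤ (f≤g (suc N)) (sumTo-mono N f g f≤g)

sumTo-const : ∀ N c → sumTo N (λ _ → c) ≡ N * c
sumTo-const zero    c = refl
sumTo-const (suc N) c = cong (c +_) (sumTo-const N c)

[_∣_] : ℕ → ℕ → ℕ
[ d ∣ x ] with d ∣? x
... | yes _ = 1
... | no  _ = 0

[∣]-yes : ∀ {d x} → d ∣ x → [ d ∣ x ] ≡ 1
[∣]-yes {d} {x} d∣x with d ∣? x
... | yes _   = refl
... | no  d∤x = ⊥-elim (d∤x d∣x)

[∣]-no : ∀ {d x} → ¬ d ∣ x → [ d ∣ x ] ≡ 0
[∣]-no {d} {x} d∤x with d ∣? x
... | yes d∣x = ⊥-elim (d∤x d∣x)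
... | no  _   = refl

multiples : ℕ → ℕ → ℕ
multiples d zero    = 0
multiples d (suc n) = [ d ∣ suc n ] + multiples d n

IsFloor : ℕ → ℕ → ℕ → Set
IsFloor d n c = c * d ≤ n × n < suc c * d

-- Counting multiples computes the floor of the quotient: when passing from
-- n to n + 1 the floor grows exactly when d divides n + 1.
multiples-floor : ∀ d .{{_ : NonZero d}} n → IsFloor d n (multiples d n)
multiples-floor d zero = z≤n , ≤-trans (>-nonZero⁻¹ d) (m≤m+n d 0)
multiples-floor d (suc n) with multiples-floor d n | d ∣? suc n
... | c*d≤n , n<[1+c]*d | yes (divides m 1+n≡m*d) = ≤-reflexive [1+c]*d≡1+n , 1+n<[2+c]*d
  where
    c : ℕ
    c = multiples d n
    m≡1+c : m ≡ suc c
    m≡1+c = ≤-antisym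
      (*-cancelʳ-≤ m (suc c) d (subst (_≤ suc c * d) 1+n≡m*d n<[1+c]*d))
      (*-cancelʳ-< d c m (≤-<-trans c*d≤n (subst (n <_) 1+n≡m*d (n<1+n n))))
    [1+c]*d≡1+n : suc c * d ≡ suc n
    [1+c]*d≡1+n = trans (cong (_* d) (sym m≡1+c)) (sym 1+n≡m*d)
    1+n<[2+c]*d : suc n < suc (suc c) * d
    1+n<[2+c]*d = subst (_< d + suc c * d) [1+c]*d≡1+n (m<n+m (suc c * d) (>-nonZero⁻¹ d))
... | c*d≤n , n<[1+c]*d | no d∤1+n = m≤n⇒m≤1+n c*d≤n , ≤∧≢⇒< n<[1+c]*d 1+n≢[1+c]*d
  where
    1+n≢[1+c]*d : suc n ≢ suc (multiples d n) * d
    1+n≢[1+c]*d eq = d∤1+n (divides (suc (multiples d n)) eq)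

-- ⌊(r + s)/d⌋ ≤ ⌊r/d⌋ + ⌊s/d⌋ + 1, since r + s < (⌊r/d⌋ + ⌊s/d⌋ + 2)·d.
multiples-subadditive : ∀ d .{{_ : NonZero d}} r s →
  multiples d (r + s) ≤ multiples d r + multiples d s + 1
multiples-subadditive d r s = subst (multiples d (r + s) ≤_) (+-suc-comm a b) (<⇒≤pred lt)
  where
    a : ℕ
    a = multiples d r
    b : ℕ
    b = multiples d s
    r+s<[a+b+2]*d : r + s < (suc a + suc b) * d
    r+s<[a+b+2]*d = subst (r + s <_) (sym (*-distribʳ-+ d (suc a) (suc b)))
      (+-mono-< (proj₂ (multiples-floor d r)) (proj₂ (multiples-floor d s)))
    lt : multiples d (r + s) < suc a + suc b
    lt = *-cancelʳ-< d (multiples d (r + s)) (suc a + suc b)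
      (≤-<-trans (proj₁ (multiples-floor d (r + s))) r+s<[a+b+2]*d)
    +-suc-comm : ∀ x y → x + suc y ≡ x + y + 1
    +-suc-comm x y = trans (+-suc x y) (+-comm 1 (x + y))

^-∣-^ : ∀ p {i j} → i ≤ j → p ^ i ∣ p ^ j
^-∣-^ p {i} {j} i≤j = subst (λ l → p ^ i ∣ p ^ l) (m+[n∸m]≡n i≤j)
  (subst (p ^ i ∣_) (sym (^-distribˡ-+-* p i (j ∸ i))) (m∣m*n (p ^ (j ∸ i))))

n<m^n : ∀ {m} → 1 < m → ∀ n → n < m ^ n
n<m^n 1<m zero    = ≤-refl
n<m^n {m@(suc _)} 1<m (suc n) =
  ≤-trans (≤-<-trans (n<m^n 1<m n) (m<m+n (m ^ n) (m≤n⇒m≤n+o 0 (m^n>0 m n))))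
          (*-monoˡ-≤ (m ^ n) 1<m)

IsOrd-intro : ∀ {p u} e .{{_ : NonZero p}} → ¬ p ∣ u → IsOrd p (u * p ^ e) e
IsOrd-intro {p} {u} e p∤u =
  divides u refl , λ p*p^e∣u*p^e → p∤u (*-cancelʳ-∣ (p ^ e) {{m^n≢0 p e}} p*p^e∣u*p^e)

IsOrd-elim : ∀ {p x e} → IsOrd p x e → ∃ λ u → x ≡ u * p ^ e × ¬ p ∣ u
IsOrd-elim {p} {x} {e} (divides u x≡u*p^e , p^[1+e]∤x) =
  u , x≡u*p^e , λ p∣u → p^[1+e]∤x (subst (p * p ^ e ∣_) (sym x≡u*p^e) (*-monoˡ-∣ (p ^ e) p∣u))

IsOrd-unique : ∀ {p x e f} → IsOrd p x e → IsOrd p x f → e ≡ f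
IsOrd-unique {p} {e = e} {f} (p^e∣x , p^[1+e]∤x) (p^f∣x , p^[1+f]∤x) with <-cmp e f
... | tri< e<f _ _ = ⊥-elim (p^[1+e]∤x (∣-trans (^-∣-^ p e<f) p^f∣x))
... | tri≈ _ e≡f _ = e≡f
... | tri> _ _ f<e = ⊥-elim (p^[1+f]∤x (∣-trans (^-∣-^ p f<e) p^e∣x))

-- Valuations add under multiplication: writing x = u·p^e and y = v·p^f,
-- Euclid's lemma for the prime p gives p ∤ u·v.
IsOrd-* : ∀ {p x y e f} → Prime p → IsOrd p x e → IsOrd p y f → IsOrd p (x * y) (e + f)
IsOrd-* {p} {e = e} {f} p-prime ox oy with IsOrd-elim {p} {e = e} ox | IsOrd-elim {p} {e = f} oy
... | u , refl , p∤u | v , refl , p∤v =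
  subst (λ z → IsOrd p z (e + f)) (sym x*y≡uv*p^[e+f])
    (IsOrd-intro (e + f) {{prime⇒nonZero p-prime}} p∤u*v)
  where
    p∤u*v : ¬ p ∣ u * v
    p∤u*v p∣u*v = [ p∤u , p∤v ]′ (euclidsLemma u v p-prime p∣u*v)
    x*y≡uv*p^[e+f] : u * p ^ e * (v * p ^ f) ≡ u * v * p ^ (e + f)
    x*y≡uv*p^[e+f] = trans (interchange *-commutativeSemigroup u (p ^ e) v (p ^ f))
      (cong (u * v *_) (sym (^-distribˡ-+-* p e f)))

IsOrd-search : ∀ {p} x j → ¬ p ^ j ∣ x → ∃ (IsOrd p x)
IsOrd-search x zero    1∤x = ⊥-elim (1∤x (1∣ x))
IsOrd-search {p} x (suc j) p^[1+j]∤x with p ^ j ∣? x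
... | yes p^j∣x = j , p^j∣x , p^[1+j]∤x
... | no  p^j∤x = IsOrd-search x j p^j∤x

IsOrd-exists : ∀ {p} → 1 < p → ∀ x .{{_ : NonZero x}} → ∃ (IsOrd p x)
IsOrd-exists {p} 1<p x = IsOrd-search x x λ p^x∣x → <⇒≱ (n<m^n 1<p x) (∣⇒≤ p^x∣x)

binomial-factorials : ∀ {n k} → k ≤ n → (n C k) * (k ! * (n ∸ k) !) ≡ n !
binomial-factorials {n} {k} k≤n = begin
  (n C k) * (k ! * (n ∸ k) !)                   ≡⟨ cong (_* (k ! * (n ∸ k) !)) (nCk≡n!/k![n-k]! k≤n) ⟩
  n ! / (k ! * (n ∸ k) !) * (k ! * (n ∸ k) !)   ≡⟨ m/n*n≡m (k![n∸k]!∣n! k≤n) ⟩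
  n !                                           ∎
  where
    open ≡-Reasoning
    instance
      k!*[n∸k]!≢0 : NonZero (k ! * (n ∸ k) !)
      k!*[n∸k]!≢0 = k !* (n ∸ k) !≢0

module _ {p : ℕ} (p-prime : Prime p) where

  private instance
    p≢0 : NonZero p
    p≢0 = prime⇒nonZero p-prime

  1<p : 1 < p
  1<p = nonTrivial⇒n>1 p {{prime⇒nonTrivial p-prime}}

  -- The valuation truncated at N: Σ_{j=1}^{N} [p^j ∣ x], which is min(N, ord_p x).
  truncOrd : ℕ → ℕ → ℕ
  truncOrd N x = sumTo N (λ j → [ p ^ j ∣ x ])

  module _ {x e} (ox : IsOrd p x e) where

    -- Every j ≤ e contributes 1, every j > e contributes 0.
    truncOrd-below : ∀ M → M ≤ e → truncOrd M x ≡ M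
    truncOrd-below zero    _     = refl
    truncOrd-below (suc M) 1+M≤e = cong₂ _+_
      ([∣]-yes (∣-trans (^-∣-^ p 1+M≤e) (proj₁ ox)))
      (truncOrd-below M (≤-trans (n≤1+n M) 1+M≤e))

    truncOrd-above : ∀ M → e ≤ M → truncOrd M x ≡ e
    truncOrd-above zero    e≤0   = sym (n≤0⇒n≡0 e≤0)
    truncOrd-above (suc M) e≤1+M with e ≤? M
    ... | yes e≤M = cong₂ _+_
      ([∣]-no λ p^[1+M]∣x → proj₂ ox (∣-trans (^-∣-^ p (s≤s e≤M)) p^[1+M]∣x))
      (truncOrd-above M e≤M)
    ... | no  e≰M = trans (truncOrd-below (suc M) (≰⇒> e≰M)) (≤-antisym (≰⇒> e≰M) e≤1+M)

  IsOrd-truncOrd : ∀ N x .{{_ : NonZero x}} → x < p ^ suc N → IsOrd p x (truncOrd N x)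
  IsOrd-truncOrd N x x<p^[1+N] with IsOrd-exists 1<p x
  ... | e , ox = subst (IsOrd p x) (sym (truncOrd-above ox N e≤N)) ox
    where
      e≤N : e ≤ N
      e≤N = ≮⇒≥ λ N<e → <⇒≱ x<p^[1+N] (≤-trans (^-monoʳ-≤ p N<e) (∣⇒≤ (proj₁ ox)))

  legendre : ℕ → ℕ → ℕ
  legendre N n = sumTo N (λ j → multiples (p ^ j) n)

  IsOrd-factorial : ∀ N n → n < p ^ suc N → IsOrd p (n !) (legendre N n)
  IsOrd-factorial N zero    _ =
    subst (IsOrd p 1) (sym (trans (sumTo-const N 0) (*-zeroʳ N))) (IsOrd-intro 0 p∤1)
    where
      p∤1 : ¬ p ∣ 1
      p∤1 p∣1 = <⇒≢ 1<p (sym (∣1⇒≡1 p∣1))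
  IsOrd-factorial N (suc n) 1+n<p^[1+N] =
    subst (IsOrd p (suc n !)) (sym (sumTo-+ N (λ j → [ p ^ j ∣ suc n ]) (λ j → multiples (p ^ j) n)))
      (IsOrd-* {e = truncOrd N (suc n)} {f = legendre N n} p-prime
        (IsOrd-truncOrd N (suc n) 1+n<p^[1+N])
        (IsOrd-factorial N n (<-trans (n<1+n n) 1+n<p^[1+N])))

  -- Each of the N floors loses at most one unit when the argument is split.
  legendre-subadditive : ∀ N r s → legendre N (r + s) ≤ legendre N r + legendre N s + N
  legendre-subadditive N r s = begin
    legendre N (r + s)
      ≤⟨ sumTo-mono N _ _ (λ j → multiples-subadditive (p ^ j) {{m^n≢0 p j}} r s) ⟩
    sumTo N (λ j → multiples (p ^ j) r + multiples (p ^ j) s + 1)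
      ≡⟨ sumTo-+ N _ (λ _ → 1) ⟩
    sumTo N (λ j → multiples (p ^ j) r + multiples (p ^ j) s) + sumTo N (λ _ → 1)
      ≡⟨ cong₂ _+_ (sumTo-+ N _ _) (trans (sumTo-const N 1) (*-identityʳ N)) ⟩
    legendre N r + legendre N s + N ∎
    where open ≤-Reasoning

  binomial-ord-bound : ∀ N n k → k ≤ n → n < p ^ suc N →
    ∃ λ e → IsOrd p (n C k) e × e ≤ N
  binomial-ord-bound N n k k≤n n<p^[1+N] = e , oC , e≤N
    where
      m : ℕ
      m = n ∸ k
      Lk+Lm : ℕ
      Lk+Lm = legendre N k + legendre N m
      binomial : (n C k) * (k ! * m !) ≡ n !
      binomial = binomial-factorials k≤n
      instance
        nCk≢0 : NonZero (n C k)
        nCk≢0 = m*n≢0⇒m≢0 (n C k) {{subst NonZero (sym binomial) (n !≢0)}}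
      e : ℕ
      e = proj₁ (IsOrd-exists 1<p (n C k))
      oC : IsOrd p (n C k) e
      oC = proj₂ (IsOrd-exists 1<p (n C k))
      -- Comparing valuations of both sides of n! = (n C k) · k! · m!.
      e+Lk+Lm≡Ln : e + Lk+Lm ≡ legendre N n
      e+Lk+Lm≡Ln = IsOrd-unique
        (subst (λ z → IsOrd p z (e + Lk+Lm)) binomial
          (IsOrd-* {e = e} {f = Lk+Lm} p-prime oC
            (IsOrd-* {e = legendre N k} {f = legendre N m} p-prime
              (IsOrd-factorial N k (≤-<-trans k≤n n<p^[1+N]))
              (IsOrd-factorial N m (≤-<-trans (m∸n≤m n k) n<p^[1+N])))))
        (IsOrd-factorial N n n<p^[1+N])
      e≤N : e ≤ N
      e≤N = +-cancelˡ-≤ Lk+Lm e N (begin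
        Lk+Lm + e              ≡⟨ +-comm Lk+Lm e ⟩
        e + Lk+Lm              ≡⟨ e+Lk+Lm≡Ln ⟩
        legendre N n           ≡⟨ cong (legendre N) (sym (m+[n∸m]≡n k≤n)) ⟩
        legendre N (k + m)     ≤⟨ legendre-subadditive N k m ⟩
        Lk+Lm + N              ∎)
        where open ≤-Reasoning

-- The theorem: the case n = p^a - k, N = a - 1.
lemma2p4 : (p a k : ℕ) → Prime p → p % 2 ≡ 1 → 1 ≤ a →
    1 ≤ k → k ≤ (p ^ a ∸ 1) / 2 →
    ∃ λ e → IsOrd p ((p ^ a ∸ k) C ((p ^ a ∸ 1) / 2 ∸ k)) e × e ≤ a ∸ 1
lemma2p4 p zero    k _       _ ()
lemma2p4 p (suc a) k p-prime _ _ 1≤k k≤half =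
  binomial-ord-bound p-prime a (q ∸ k) (half ∸ k)
    (∸-monoˡ-≤ k half≤q) (∸-monoʳ-< 1≤k (≤-trans k≤half half≤q))
  where
    q : ℕ
    q = p ^ suc a
    half : ℕ
    half = (q ∸ 1) / 2
    half≤q : half ≤ q
    half≤q = ≤-trans (m/n≤m (q ∸ 1) 2) (m∸n≤m q 1)
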